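{- Let $E_1\cup E_2$ be a finite set of equations and let $E_1$ be WNSTO. If $E_1$ is not unifiable, then $E_1\cup E_2$ is WNSTO. If $\theta_1$ is an mgu of $E_1$ and $E_2\theta_1$ is WNSTO, then $E_1\cup E_2$ is WNSTO.
   Context: MMA (Martelli–Montanari algorithm) operates on a finite set of equations by nondeterministically choosing an equation and applying: (1) $f(s_1,\ldots,s_n)\doteq f(t_1,\ldots,t_n)$ → replace by $s_1\doteq t_1,\ldots,s_n\doteq t_n$; (2) $f(\ldots)\doteq g(\ldots)$ with $f\ne g$ → halt with failure; (3) $X\doteq X$ → delete; (4) $t\doteq X$ with $t$ not a variable → replace by $X\doteq t$; (5) $X\doteq t$ with $X\notin Var(t)$ and $X$ occurring elsewhere → apply $\{X/t\}$ to all other equations; (6) $X\doteq t$ with $X\in Var(t)$, $X\ne t$ → halt with failure. A run is a maximal sequence of equation sets obtained by successive actions. An equation set is WNSTO (weakly not subject to occur-check) if there exists a run of MMA on it in which action (6) is not performed. -}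

module Defs where

open import Data.Nat using (ℕ; suc; _≡ᵇ_)
open import Data.Bool using (if_then_else_)
open import Data.List using (List; []; _∷_; _++_; length; zip; map)
open import Data.List.Membership.Propositional using (_∉_)
open import Data.List.Relation.Unary.Any using (Any)
open import Data.List.Relation.Unary.All using (All)
open import Data.Product using (Σ; _×_; _,_; proj₁; proj₂; ∃)
open import Data.Sum using (_⊎_)
open import Relation.Binary.PropositionalEquality using (_≡_; _≢_)
open import Relation.Nullary using (¬_)

-- A function symbol is identified by its
-- name together with its arity (the length of its argument list), so
-- f(s1..sn) and g(t1..tm) have "the same symbol" iff f ≡ g and n ≡ m.

data Term (F : Set) : Set where
  var : ℕ → Term F
  fn  : F → List (Term F) → Term F

Eqn : Set → Set
Eqn F = Term F × Term F

data _occursIn_ {F : Set} (x : ℕ) : Term F → Set where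
  here   : x occursIn var x
  inArgs : ∀ {f ts} → Any (x occursIn_) ts → x occursIn fn f ts

OccursInEqs : {F : Set} → ℕ → List (Eqn F) → Set
OccursInEqs x E = Any (λ e → x occursIn proj₁ e ⊎ x occursIn proj₂ e) E

RawSubst : Set → Set
RawSubst F = ℕ → Term F

mutual
  sub : {F : Set} → Term F → RawSubst F → Term F
  sub (var x)    σ = σ x
  sub (fn f ts)  σ = fn f (subs ts σ)

  subs : {F : Set} → List (Term F) → RawSubst F → List (Term F)
  subs []       σ = []
  subs (t ∷ ts) σ = sub t σ ∷ subs ts σ

subEq : {F : Set} → RawSubst F → Eqn F → Eqn F
subEq σ (s , t) = (sub s σ , sub t σ)

[_↦_] : {F : Set} → ℕ → Term F → RawSubst F
[ x ↦ t ] y = if y ≡ᵇ x then t else var y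

Subst : Set → Set
Subst F = Σ (RawSubst F) λ σ → ∃ λ (dom : List ℕ) → ∀ x → x ∉ dom → σ x ≡ var x

Unifier : {F : Set} → RawSubst F → List (Eqn F) → Set
Unifier σ E = All (λ e → sub (proj₁ e) σ ≡ sub (proj₂ e) σ) E

Unifiable : {F : Set} → List (Eqn F) → Set
Unifiable {F} E = Σ (Subst F) λ σ → Unifier (proj₁ σ) E

IsMGU : {F : Set} → RawSubst F → List (Eqn F) → Set
IsMGU {F} θ E =
  Unifier θ E ×
  ((η : Subst F) → Unifier (proj₁ η) E →
     Σ (Subst F) λ δ → ∀ x → proj₁ η x ≡ sub (θ x) (proj₁ δ))

-- The Martelli–Montanari algorithm.  A finite set of equations is
-- represented by a list; an equation is chosen nondeterministically by
-- splitting the list as xs ++ e ∷ ys.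

data Action : Set where
  a1 a2 a3 a4 a5 a6 : Action

data Result (F : Set) : Set where
  failure : Result F
  cont    : List (Eqn F) → Result F

data Step {F : Set} : Action → List (Eqn F) → Result F → Set where
  act1 : ∀ xs ys f ss ts → length ss ≡ length ts →
         Step a1 (xs ++ (fn f ss , fn f ts) ∷ ys) (cont (xs ++ zip ss ts ++ ys))
  act2 : ∀ xs ys f g ss ts → (f ≢ g ⊎ length ss ≢ length ts) →
         Step a2 (xs ++ (fn f ss , fn g ts) ∷ ys) failure
  act3 : ∀ xs ys x →
         Step a3 (xs ++ (var x , var x) ∷ ys) (cont (xs ++ ys))
  act4 : ∀ xs ys t x → (∀ y → t ≢ var y) →
         Step a4 (xs ++ (t , var x) ∷ ys) (cont (xs ++ (var x , t) ∷ ys))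
  act5 : ∀ xs ys x t → ¬ (x occursIn t) → OccursInEqs x (xs ++ ys) →
         Step a5 (xs ++ (var x , t) ∷ ys)
                 (cont (map (subEq [ x ↦ t ]) xs ++ (var x , t) ∷ map (subEq [ x ↦ t ]) ys))
  act6 : ∀ xs ys x t → x occursIn t → t ≢ var x →
         Step a6 (xs ++ (var x , t) ∷ ys) failure

Terminal : {F : Set} → List (Eqn F) → Set
Terminal E = ∀ a r → ¬ Step a E r

data Run¬6 {F : Set} : List (Eqn F) → Set where
  halt     : ∀ {E} → Terminal E → Run¬6 E
  failStep : ∀ {a E} → a ≢ a6 → Step a E failure → Run¬6 E
  step     : ∀ {a E E′} → a ≢ a6 → Step a E (cont E′) → Run¬6 E′ → Run¬6 E

InfRun¬6 : {F : Set} → List (Eqn F) → Set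
InfRun¬6 {F} E =
  Σ (ℕ → List (Eqn F)) λ s → (s 0 ≡ E) ×
    (∀ n → Σ Action λ a → (a ≢ a6) × Step a (s n) (cont (s (suc n))))

WNSTO : {F : Set} → List (Eqn F) → Set
WNSTO E = Run¬6 E ⊎ InfRun¬6 E

module Submission where

-- An infinite run of E₁ is also a run of E₁ ∪ E₂. Otherwise, follow the finite run of E₁ inside
-- E₁ ∪ E₂: each action on E₁ is an action on the larger set, where action (5) also substitutes
-- into the current copy G of E₂. The run ends with a failure by action (2), which leaves the
-- combined run free of action (6), or with a solved form S, whose solution unifies S and hence E₁.
-- So if E₁ is not unifiable, the run fails. If θ₁ is an mgu of E₁, it unifies every set of the
-- run, so the run ends in S, and Gθ₁ = E₂θ₁. Applying action (5) with the equations of S removes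
-- the variables of dom S from G. Then the solution of S, which factors as θ₁δ, is the identity on
-- G, so G is a renaming of Gθ₁ = E₂θ₁, and runs commute with renamings. Finally G is run next to
-- S: action (5) on G substitutes into S, which stays solved, and a last round of action (5) with
-- the solved form reached by G makes the whole set solved.

open import Defs
open import Data.Nat using (ℕ; zero; suc; _≡ᵇ_)
open import Data.Nat.Properties using (_≟_; ≡ᵇ⇒≡; ≡⇒≡ᵇ; suc-injective)
open import Data.Bool using (true; false)
open import Data.Unit using (tt)
open import Data.Empty using (⊥-elim)
open import Data.List using (List; []; _∷_; _++_; [_]; length; zip; map)
open import Data.List.Properties using (map-++; ++-assoc; ++-identityʳ; ∷-injective)
open import Data.List.Relation.Unary.Any using (Any; here; there)
open import Data.List.Relation.Unary.Any.Properties using (++⁺ˡ; ++⁺ʳ; ++⁻)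
open import Data.List.Relation.Unary.All as All using ([]; _∷_)
import Data.List.Relation.Unary.All.Properties as All
open import Data.List.Membership.Propositional using (_∈_; lose)
open import Data.List.Membership.Propositional.Properties using (∈-∃++; ∈-insert; ∈-++⁻; ∈-++⁺ˡ; ∈-map⁻)
open import Data.Product as Product using (Σ; ∃; ∃₂; _×_; _,_; proj₁; proj₂)
open import Data.Sum as Sum using (_⊎_; inj₁; inj₂)
open import Data.Product.Properties using (,-injectiveˡ; ,-injectiveʳ)
open import Relation.Binary.PropositionalEquality hiding ([_])
open import Relation.Binary.Construct.Closure.ReflexiveTransitive using (Star; ε; _◅_; _◅◅_)
open import Relation.Nullary using (¬_; Dec; yes; no)
open import Function using (_∘_; id; const)

module _ {A : Set} where

  ++∷≡++⁻ : ∀ (xs : List A) {e ys P T} → xs ++ e ∷ ys ≡ P ++ T →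
            (∃ λ ys₁ → P ≡ xs ++ e ∷ ys₁ × ys ≡ ys₁ ++ T) ⊎ (∃ λ xs₂ → T ≡ xs₂ ++ e ∷ ys × xs ≡ P ++ xs₂)
  ++∷≡++⁻ xs       {P = []}    eq   = inj₂ (xs , sym eq , refl)
  ++∷≡++⁻ []       {P = p ∷ P} refl = inj₁ (P , refl , refl)
  ++∷≡++⁻ (x ∷ xs) {P = p ∷ P} eq with ∷-injective eq
  ... | refl , eq′ = Sum.map (Product.map₂ (Product.map₁ (cong (x ∷_))))
                             (Product.map₂ (Product.map₂ (cong (x ∷_))))
                             (++∷≡++⁻ xs eq′)

  map≡++∷⁻ : ∀ {B : Set} (f : A → B) (as : List A) {xs′ e′ ys′} → map f as ≡ xs′ ++ e′ ∷ ys′ →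
             ∃₂ λ xs ys → ∃ λ e → as ≡ xs ++ e ∷ ys × xs′ ≡ map f xs × e′ ≡ f e × ys′ ≡ map f ys
  map≡++∷⁻ f (a ∷ as) {[]}      refl = [] , as , a , refl , refl , refl , refl
  map≡++∷⁻ f (a ∷ as) {x ∷ xs′} eq with ∷-injective eq
  ... | refl , eq′ with map≡++∷⁻ f as eq′
  ... | xs , ys , e , refl , refl , refl , refl = a ∷ xs , ys , e , refl , refl , refl , refl

module _ {F : Set} where

  private
    Tm : Set
    Tm = Term F
    Eqns : Set
    Eqns = List (Eqn F)

  -- Substitutions

  _⨾_ : RawSubst F → RawSubst F → RawSubst F
  (σ ⨾ τ) x = sub (σ x) τ

  mutual
    sub-cong : ∀ (t : Tm) {σ τ} → (∀ x → x occursIn t → σ x ≡ τ x) → sub t σ ≡ sub t τ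
    sub-cong (var x)   eq = eq x here
    sub-cong (fn f ts) eq = cong (fn f) (subs-cong ts λ x p → eq x (inArgs p))

    subs-cong : ∀ (ts : List Tm) {σ τ} → (∀ x → Any (x occursIn_) ts → σ x ≡ τ x) → subs ts σ ≡ subs ts τ
    subs-cong []       eq = refl
    subs-cong (t ∷ ts) eq = cong₂ _∷_ (sub-cong t λ x p → eq x (here p)) (subs-cong ts λ x p → eq x (there p))

  mutual
    sub-⨾ : ∀ (t : Tm) σ τ → sub (sub t σ) τ ≡ sub t (σ ⨾ τ)
    sub-⨾ (var x)   σ τ = refl
    sub-⨾ (fn f ts) σ τ = cong (fn f) (subs-⨾ ts σ τ)

    subs-⨾ : ∀ (ts : List Tm) σ τ → subs (subs ts σ) τ ≡ subs ts (σ ⨾ τ)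
    subs-⨾ []       σ τ = refl
    subs-⨾ (t ∷ ts) σ τ = cong₂ _∷_ (sub-⨾ t σ τ) (subs-⨾ ts σ τ)

  mutual
    sub-identity : ∀ (t : Tm) → sub t var ≡ t
    sub-identity (var x)   = refl
    sub-identity (fn f ts) = cong (fn f) (subs-identity ts)

    subs-identity : ∀ (ts : List Tm) → subs ts var ≡ ts
    subs-identity []       = refl
    subs-identity (t ∷ ts) = cong₂ _∷_ (sub-identity t) (subs-identity ts)

  sub-identityOn : ∀ (t : Tm) {σ} → (∀ x → x occursIn t → σ x ≡ var x) → sub t σ ≡ t
  sub-identityOn t eq = trans (sub-cong t eq) (sub-identity t)

  length-subs : ∀ (ts : List Tm) σ → length (subs ts σ) ≡ length ts
  length-subs []       σ = refl
  length-subs (t ∷ ts) σ = cong suc (length-subs ts σ)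

  mutual
    occurs-sub⁻ : ∀ {x} (t : Tm) σ → x occursIn sub t σ → ∃ λ z → z occursIn t × x occursIn σ z
    occurs-sub⁻ (var z)   σ p = z , here , p
    occurs-sub⁻ (fn f ts) σ (inArgs p) = Product.map₂ (Product.map₁ inArgs) (occurs-subs⁻ ts σ p)

    occurs-subs⁻ : ∀ {x} (ts : List Tm) σ → Any (x occursIn_) (subs ts σ) →
                   ∃ λ z → Any (z occursIn_) ts × x occursIn σ z
    occurs-subs⁻ (t ∷ ts) σ (here p)  = Product.map₂ (Product.map₁ here) (occurs-sub⁻ t σ p)
    occurs-subs⁻ (t ∷ ts) σ (there p) = Product.map₂ (Product.map₁ there) (occurs-subs⁻ ts σ p)

  mutual
    occurs-sub⁺ : ∀ {x z} (t : Tm) σ → z occursIn t → x occursIn σ z → x occursIn sub t σ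
    occurs-sub⁺ (var z)   σ here       r = r
    occurs-sub⁺ (fn f ts) σ (inArgs q) r = inArgs (occurs-subs⁺ ts σ q r)

    occurs-subs⁺ : ∀ {x z} (ts : List Tm) σ → Any (z occursIn_) ts → x occursIn σ z →
                   Any (x occursIn_) (subs ts σ)
    occurs-subs⁺ (t ∷ ts) σ (here q)  r = here (occurs-sub⁺ t σ q r)
    occurs-subs⁺ (t ∷ ts) σ (there q) r = there (occurs-subs⁺ ts σ q r)

  occurs-var : ∀ {x y} → x occursIn var {F} y → x ≡ y
  occurs-var here = refl

  sub≡var⁻ : ∀ (t : Tm) σ {z} → sub t σ ≡ var z → ∃ λ w → t ≡ var w × σ w ≡ var z
  sub≡var⁻ (var w) σ eq = w , refl , eq

  mutual
    occurs? : ∀ x (t : Tm) → Dec (x occursIn t)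
    occurs? x (var y) with x ≟ y
    ... | yes refl = yes here
    ... | no x≢y   = no λ p → x≢y (occurs-var p)
    occurs? x (fn f ts) with occursAny? x ts
    ... | yes p = yes (inArgs p)
    ... | no ¬p = no λ { (inArgs p) → ¬p p }

    occursAny? : ∀ x (ts : List Tm) → Dec (Any (x occursIn_) ts)
    occursAny? x []       = no λ ()
    occursAny? x (t ∷ ts) with occurs? x t | occursAny? x ts
    ... | yes p | _     = yes (here p)
    ... | no _  | yes q = yes (there q)
    ... | no ¬p | no ¬q = no λ { (here p) → ¬p p ; (there q) → ¬q q }

  ↦-self : ∀ x (t : Tm) → [ x ↦ t ] x ≡ t
  ↦-self x t with x ≡ᵇ x | ≡⇒≡ᵇ x x refl
  ... | true | _ = refl

  ↦-other : ∀ {x y} (t : Tm) → y ≢ x → [ x ↦ t ] y ≡ var y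
  ↦-other {x} {y} t y≢x with y ≡ᵇ x | ≡ᵇ⇒≡ y x
  ... | true  | y≡x = ⊥-elim (y≢x (y≡x tt))
  ... | false | _   = refl

  occurs-↦⁻ : ∀ {z x} (u t : Tm) → z occursIn sub u [ x ↦ t ] → z occursIn u × z ≢ x ⊎ z occursIn t
  occurs-↦⁻ {z} {x} u t p with occurs-sub⁻ u [ x ↦ t ] p
  ... | w , w∈u , z∈w with w ≟ x
  ... | yes refl = inj₂ (subst (z occursIn_) (↦-self x t) z∈w)
  ... | no w≢x with occurs-var (subst (z occursIn_) (↦-other t w≢x) z∈w)
  ... | refl = inj₁ (w∈u , w≢x)

  ↦-absorb : ∀ {x} {t : Tm} η → η x ≡ sub t η → ∀ u → sub (sub u [ x ↦ t ]) η ≡ sub u η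
  ↦-absorb {x} {t} η ηx≡ηt u = trans (sub-⨾ u [ x ↦ t ] η) (sub-cong u absorb)
    where
    absorb : ∀ y → y occursIn u → sub ([ x ↦ t ] y) η ≡ η y
    absorb y _ with y ≟ x
    ... | yes refl = trans (cong (λ v → sub v η) (↦-self x t)) (sym ηx≡ηt)
    ... | no y≢x   = cong (λ v → sub v η) (↦-other t y≢x)

  _occursInEq_ : ℕ → Eqn F → Set
  x occursInEq e = x occursIn proj₁ e ⊎ x occursIn proj₂ e

  occursInEqs? : ∀ x (E : Eqns) → Dec (OccursInEqs x E)
  occursInEqs? x []            = no λ ()
  occursInEqs? x ((s , t) ∷ E) with occurs? x s | occurs? x t | occursInEqs? x E
  ... | yes p | _     | _     = yes (here (inj₁ p))
  ... | no _  | yes q | _     = yes (here (inj₂ q))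
  ... | no _  | no _  | yes r = yes (there r)
  ... | no ¬p | no ¬q | no ¬r = no λ { (here (inj₁ p)) → ¬p p ; (here (inj₂ q)) → ¬q q
                                     ; (there r) → ¬r r }

  subEqs : RawSubst F → Eqns → Eqns
  subEqs σ = map (subEq σ)

  occurs-subEqs⁻ : ∀ {x} σ (E : Eqns) → OccursInEqs x (subEqs σ E) → ∃ λ z → OccursInEqs z E × x occursIn σ z
  occurs-subEqs⁻ σ ((s , t) ∷ E) (here (inj₁ p)) = Product.map₂ (Product.map₁ λ q → here (inj₁ q)) (occurs-sub⁻ s σ p)
  occurs-subEqs⁻ σ ((s , t) ∷ E) (here (inj₂ p)) = Product.map₂ (Product.map₁ λ q → here (inj₂ q)) (occurs-sub⁻ t σ p)
  occurs-subEqs⁻ σ (e ∷ E)       (there p)       = Product.map₂ (Product.map₁ there) (occurs-subEqs⁻ σ E p)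

  occurs-subEqs⁺ : ∀ {x z} σ (E : Eqns) → OccursInEqs z E → x occursIn σ z → OccursInEqs x (subEqs σ E)
  occurs-subEqs⁺ σ ((s , t) ∷ E) (here (inj₁ q)) r = here (inj₁ (occurs-sub⁺ s σ q r))
  occurs-subEqs⁺ σ ((s , t) ∷ E) (here (inj₂ q)) r = here (inj₂ (occurs-sub⁺ t σ q r))
  occurs-subEqs⁺ σ (e ∷ E)       (there q)       r = there (occurs-subEqs⁺ σ E q r)

  occurs-subEqs-↦⁻ : ∀ {z x} {t : Tm} (E : Eqns) → OccursInEqs z (subEqs [ x ↦ t ] E) →
                     OccursInEqs z E × z ≢ x ⊎ z occursIn t
  occurs-subEqs-↦⁻ {z} {x} {t} E p with occurs-subEqs⁻ [ x ↦ t ] E p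
  ... | w , w∈E , z∈w with w ≟ x
  ... | yes refl = inj₂ (subst (z occursIn_) (↦-self x t) z∈w)
  ... | no w≢x with occurs-var (subst (z occursIn_) (↦-other t w≢x) z∈w)
  ... | refl = inj₁ (w∈E , w≢x)

  subEqs-cong : ∀ (E : Eqns) {σ τ} → (∀ z → OccursInEqs z E → σ z ≡ τ z) → subEqs σ E ≡ subEqs τ E
  subEqs-cong []            eq = refl
  subEqs-cong ((s , t) ∷ E) eq =
    cong₂ _∷_ (cong₂ _,_ (sub-cong s λ z p → eq z (here (inj₁ p))) (sub-cong t λ z p → eq z (here (inj₂ p))))
              (subEqs-cong E λ z p → eq z (there p))

  subEqs-⨾ : ∀ (E : Eqns) σ τ → subEqs τ (subEqs σ E) ≡ subEqs (σ ⨾ τ) E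
  subEqs-⨾ []            σ τ = refl
  subEqs-⨾ ((s , t) ∷ E) σ τ = cong₂ _∷_ (cong₂ _,_ (sub-⨾ s σ τ) (sub-⨾ t σ τ)) (subEqs-⨾ E σ τ)

  subEqs-identityOn : ∀ (E : Eqns) {σ} → (∀ z → OccursInEqs z E → σ z ≡ var z) → subEqs σ E ≡ E
  subEqs-identityOn []            eq = refl
  subEqs-identityOn ((s , t) ∷ E) eq =
    cong₂ _∷_ (cong₂ _,_ (sub-identityOn s λ z p → eq z (here (inj₁ p)))
                         (sub-identityOn t λ z p → eq z (here (inj₂ p))))
              (subEqs-identityOn E λ z p → eq z (there p))

  subEqs-↦-fresh : ∀ {x} {t : Tm} (E : Eqns) → ¬ OccursInEqs x E → subEqs [ x ↦ t ] E ≡ E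
  subEqs-↦-fresh {t = t} E x∉E = subEqs-identityOn E λ z z∈E → ↦-other t λ { refl → x∉E z∈E }

  subEqs-↦-absorb : ∀ {x} {t : Tm} η → η x ≡ sub t η → ∀ E → subEqs η (subEqs [ x ↦ t ] E) ≡ subEqs η E
  subEqs-↦-absorb η eq []            = refl
  subEqs-↦-absorb η eq ((s , u) ∷ E) =
    cong₂ _∷_ (cong₂ _,_ (↦-absorb η eq s) (↦-absorb η eq u)) (subEqs-↦-absorb η eq E)

  unifier-↦⁺ : ∀ {x} {t : Tm} η → η x ≡ sub t η → ∀ E → Unifier η E → Unifier η (subEqs [ x ↦ t ] E)
  unifier-↦⁺ η eq []            []       = []
  unifier-↦⁺ η eq ((s , u) ∷ E) (p ∷ ps) =
    trans (↦-absorb η eq s) (trans p (sym (↦-absorb η eq u))) ∷ unifier-↦⁺ η eq E ps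

  unifier-↦⁻ : ∀ {x} {t : Tm} η → η x ≡ sub t η → ∀ E → Unifier η (subEqs [ x ↦ t ] E) → Unifier η E
  unifier-↦⁻ η eq []            []       = []
  unifier-↦⁻ η eq ((s , u) ∷ E) (p ∷ ps) =
    trans (sym (↦-absorb η eq s)) (trans p (↦-absorb η eq u)) ∷ unifier-↦⁻ η eq E ps

  -- Steps inside a larger set of equations

  _⊆ᵛ_ : Eqns → Eqns → Set
  E′ ⊆ᵛ E = ∀ z → OccursInEqs z E′ → OccursInEqs z E

  _⟶_ : Eqns → Eqns → Set
  E ⟶ E′ = ∃ λ a → a ≢ a6 × Step a E (cont E′)

  _⟶*_ : Eqns → Eqns → Set
  _⟶*_ = Star _⟶_

  -- Only action (5) changes the equations around the one it acts on, by substituting into them.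
  data Update (E′ : Eqns) : Set where
    keep      : Update E′
    eliminate : ∀ x t → (var x , t) ∈ E′ → Update E′

  apply : ∀ {E′} → Update E′ → Eqns → Eqns
  apply keep                G = G
  apply (eliminate x t _) G = subEqs [ x ↦ t ] G

  apply-[] : ∀ {E′} (u : Update E′) → apply u [] ≡ []
  apply-[] keep              = refl
  apply-[] (eliminate _ _ _) = refl

  step-update : ∀ {a} {E E′ : Eqns} → Step a E (cont E′) → Update E′
  step-update (act5 xs ys x t _ _) = eliminate x t (∈-insert (subEqs [ x ↦ t ] xs))
  step-update _                    = keep

  private
    reassoc : ∀ (P xs ys G : Eqns) → P ++ (xs ++ ys) ++ G ≡ (P ++ xs) ++ ys ++ G
    reassoc P xs ys G = trans (cong (P ++_) (++-assoc xs ys G)) (sym (++-assoc P xs (ys ++ G)))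

    Any-in-context : ∀ {Q : Eqn F → Set} P xs ys G → Any Q (xs ++ ys) → Any Q ((P ++ xs) ++ ys ++ G)
    Any-in-context P xs ys G q with ++⁻ xs q
    ... | inj₁ q∈xs = ++⁺ˡ (++⁺ʳ P q∈xs)
    ... | inj₂ q∈ys = ++⁺ʳ (P ++ xs) (++⁺ˡ q∈ys)

    Step-cast : ∀ {a} {L₁ L₂ L₁′ L₂′ : Eqns} → L₁ ≡ L₂ → L₁′ ≡ L₂′ → Step a L₁ (cont L₁′) → Step a L₂ (cont L₂′)
    Step-cast refl refl s = s

  step-in-context : ∀ {a} {E E′ : Eqns} (s : Step a E (cont E′)) (P G : Eqns) →
                    Step a (P ++ E ++ G) (cont (apply (step-update s) P ++ E′ ++ apply (step-update s) G))
  step-in-context (act1 xs ys f ss ts l) P G =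
    Step-cast (sym (reassoc P xs _ G))
              (sym (trans (reassoc P xs _ G) (cong ((P ++ xs) ++_) (++-assoc (zip ss ts) ys G))))
              (act1 (P ++ xs) (ys ++ G) f ss ts l)
  step-in-context (act3 xs ys x) P G =
    Step-cast (sym (reassoc P xs _ G)) (sym (reassoc P xs ys G)) (act3 (P ++ xs) (ys ++ G) x)
  step-in-context (act4 xs ys t x t≢var) P G =
    Step-cast (sym (reassoc P xs _ G)) (sym (reassoc P xs _ G)) (act4 (P ++ xs) (ys ++ G) t x t≢var)
  step-in-context (act5 xs ys x t x∉t x∈xs++ys) P G =
    Step-cast (sym (reassoc P xs _ G)) substituted
              (act5 (P ++ xs) (ys ++ G) x t x∉t (Any-in-context P xs ys G x∈xs++ys))
    where
    σ : Eqn F → Eqn F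
    σ = subEq [ x ↦ t ]
    substituted : map σ (P ++ xs) ++ (var x , t) ∷ map σ (ys ++ G) ≡
                  map σ P ++ (map σ xs ++ (var x , t) ∷ map σ ys) ++ map σ G
    substituted = trans (cong₂ (λ L L′ → L ++ (var x , t) ∷ L′) (map-++ σ P xs) (map-++ σ ys G))
                        (sym (reassoc (map σ P) (map σ xs) _ (map σ G)))

  failure-in-context : ∀ {a} {E : Eqns} → Step a E failure → (P G : Eqns) → Step a (P ++ E ++ G) failure
  failure-in-context (act2 xs ys f g ss ts clash) P G =
    subst (λ L → Step a2 L failure) (sym (reassoc P xs _ G)) (act2 (P ++ xs) (ys ++ G) f g ss ts clash)
  failure-in-context (act6 xs ys x t x∈t t≢x) P G =
    subst (λ L → Step a6 L failure) (sym (reassoc P xs _ G)) (act6 (P ++ xs) (ys ++ G) x t x∈t t≢x)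

  step-++ʳ : ∀ {a} {E E′ : Eqns} (s : Step a E (cont E′)) (G : Eqns) →
             Step a (E ++ G) (cont (E′ ++ apply (step-update s) G))
  step-++ʳ {E′ = E′} s G =
    Step-cast refl (cong (_++ E′ ++ apply (step-update s) G) (apply-[] (step-update s))) (step-in-context s [] G)

  step-++ˡ : ∀ {a} {E E′ : Eqns} (s : Step a E (cont E′)) (P : Eqns) →
             Step a (P ++ E) (cont (apply (step-update s) P ++ E′))
  step-++ˡ {E′ = E′} s P =
    Step-cast (cong (P ++_) (++-identityʳ _))
              (cong (apply u P ++_) (trans (cong (E′ ++_) (apply-[] u)) (++-identityʳ E′)))
              (step-in-context s P [])
    where
    u : Update E′
    u = step-update s

  infRun-cons : ∀ {E E′ : Eqns} → E ⟶ E′ → InfRun¬6 E′ → InfRun¬6 E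
  infRun-cons {E} (a , a≢6 , s) (run , refl , next) = run′ , refl , next′
    where
    run′ : ℕ → Eqns
    run′ zero    = E
    run′ (suc n) = run n
    next′ : ∀ n → Σ Action λ b → b ≢ a6 × Step b (run′ n) (cont (run′ (suc n)))
    next′ zero    = a , a≢6 , s
    next′ (suc n) = next n

  wnsto-prepend : ∀ {E E′ : Eqns} → E ⟶* E′ → WNSTO E′ → WNSTO E
  wnsto-prepend ε                           w        = w
  wnsto-prepend (st@(_ , a≢6 , s) ◅ steps) w with wnsto-prepend steps w
  ... | inj₁ run = inj₁ (step a≢6 s run)
  ... | inj₂ inf = inj₂ (infRun-cons st inf)

  infRun-in-context : ∀ {E : Eqns} → InfRun¬6 E → (P G : Eqns) → InfRun¬6 (P ++ E ++ G)
  infRun-in-context {E} (run , run0≡E , next) P G = run′ , cong (λ L → P ++ L ++ G) run0≡E , next′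
    where
    update : ∀ n → Update (run (suc n))
    update n = step-update (proj₂ (proj₂ (next n)))
    context : ℕ → Eqns × Eqns
    context zero    = P , G
    context (suc n) = Product.map (apply (update n)) (apply (update n)) (context n)
    run′ : ℕ → Eqns
    run′ n = proj₁ (context n) ++ run n ++ proj₂ (context n)
    next′ : ∀ n → Σ Action λ a → a ≢ a6 × Step a (run′ n) (cont (run′ (suc n)))
    next′ n with next n
    ... | a , a≢6 , s = a , a≢6 , step-in-context s (proj₁ (context n)) (proj₂ (context n))

  fn-injective : ∀ {f g : F} {ss ts : List Tm} → fn f ss ≡ fn g ts → f ≡ g × ss ≡ ts
  fn-injective refl = refl , refl

  var-injective : ∀ {x y} → var {F} x ≡ var y → x ≡ y
  var-injective refl = refl

  unifier-zip⁺ : ∀ {η} (ss ts : List Tm) → subs ss η ≡ subs ts η → Unifier η (zip ss ts)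
  unifier-zip⁺ []       ts       eq = []
  unifier-zip⁺ (s ∷ ss) []       eq = []
  unifier-zip⁺ (s ∷ ss) (t ∷ ts) eq = proj₁ (∷-injective eq) ∷ unifier-zip⁺ ss ts (proj₂ (∷-injective eq))

  unifier-zip⁻ : ∀ {η} (ss ts : List Tm) → length ss ≡ length ts → Unifier η (zip ss ts) → subs ss η ≡ subs ts η
  unifier-zip⁻ []       []       _   _        = refl
  unifier-zip⁻ (s ∷ ss) (t ∷ ts) len (eq ∷ u) = cong₂ _∷_ eq (unifier-zip⁻ ss ts (suc-injective len) u)

  unifier-step⁺ : ∀ {a} {E E′ : Eqns} η → Step a E (cont E′) → Unifier η E → Unifier η E′
  unifier-step⁺ η (act1 xs ys f ss ts _) u with All.++⁻ xs u
  ... | uxs , ue ∷ uys = All.++⁺ uxs (All.++⁺ (unifier-zip⁺ ss ts (proj₂ (fn-injective ue))) uys)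
  unifier-step⁺ η (act3 xs ys x) u with All.++⁻ xs u
  ... | uxs , _ ∷ uys = All.++⁺ uxs uys
  unifier-step⁺ η (act4 xs ys t x _) u with All.++⁻ xs u
  ... | uxs , ue ∷ uys = All.++⁺ uxs (sym ue ∷ uys)
  unifier-step⁺ η (act5 xs ys x t _ _) u with All.++⁻ xs u
  ... | uxs , ue ∷ uys = All.++⁺ (unifier-↦⁺ η ue xs uxs) (ue ∷ unifier-↦⁺ η ue ys uys)

  unifier-step⁻ : ∀ {a} {E E′ : Eqns} η → Step a E (cont E′) → Unifier η E′ → Unifier η E
  unifier-step⁻ η (act1 xs ys f ss ts len) u with All.++⁻ xs u
  ... | uxs , uzys with All.++⁻ (zip ss ts) uzys
  ... | uz , uys = All.++⁺ uxs (cong (fn f) (unifier-zip⁻ ss ts len uz) ∷ uys)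
  unifier-step⁻ η (act3 xs ys x) u with All.++⁻ xs u
  ... | uxs , uys = All.++⁺ uxs (refl ∷ uys)
  unifier-step⁻ η (act4 xs ys t x _) u with All.++⁻ xs u
  ... | uxs , ue ∷ uys = All.++⁺ uxs (sym ue ∷ uys)
  unifier-step⁻ η (act5 xs ys x t _ _) u with All.++⁻ (subEqs [ x ↦ t ] xs) u
  ... | uxs , ue ∷ uys = All.++⁺ (unifier-↦⁻ η ue xs uxs) (ue ∷ unifier-↦⁻ η ue ys uys)

  unifier-steps⁺ : ∀ {E E′ : Eqns} η → E ⟶* E′ → Unifier η E → Unifier η E′
  unifier-steps⁺ η ε                  u = u
  unifier-steps⁺ η ((_ , _ , s) ◅ ss) u = unifier-steps⁺ η ss (unifier-step⁺ η s u)

  unifier-steps⁻ : ∀ {E E′ : Eqns} η → E ⟶* E′ → Unifier η E′ → Unifier η E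
  unifier-steps⁻ η ε                  u = u
  unifier-steps⁻ η ((_ , _ , s) ◅ ss) u = unifier-step⁻ η s (unifier-steps⁻ η ss u)

  failure-¬unifier : ∀ {a} {E : Eqns} η → a ≢ a6 → Step a E failure → ¬ Unifier η E
  failure-¬unifier η _ (act2 xs ys f g ss ts clash) u with All.++⁻ xs u
  ... | _ , ue ∷ _ with fn-injective ue | clash
  ... | f≡g , _     | inj₁ f≢g     = f≢g f≡g
  ... | _   , ss≡ts | inj₂ len-ss≢ts =
    len-ss≢ts (trans (sym (length-subs ss η)) (trans (cong length ss≡ts) (length-subs ts η)))
  failure-¬unifier η a6≢a6 (act6 _ _ _ _ _ _) _ = a6≢a6 refl

  occurs-zip : ∀ {z} (ss ts : List Tm) → OccursInEqs z (zip ss ts) → Any (z occursIn_) ss ⊎ Any (z occursIn_) ts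
  occurs-zip (s ∷ ss) (t ∷ ts) (here (inj₁ p)) = inj₁ (here p)
  occurs-zip (s ∷ ss) (t ∷ ts) (here (inj₂ p)) = inj₂ (here p)
  occurs-zip (s ∷ ss) (t ∷ ts) (there p)       = Sum.map there there (occurs-zip ss ts p)

  step-vars⊆ : ∀ {a} {E E′ : Eqns} → Step a E (cont E′) → E′ ⊆ᵛ E
  step-vars⊆ (act1 xs ys f ss ts _) _ p with ++⁻ xs p
  ... | inj₁ p∈xs = ++⁺ˡ p∈xs
  ... | inj₂ p∈zys with ++⁻ (zip ss ts) p∈zys
  ... | inj₂ p∈ys = ++⁺ʳ xs (there p∈ys)
  ... | inj₁ p∈zip = ++⁺ʳ xs (here (Sum.map inArgs inArgs (occurs-zip ss ts p∈zip)))
  step-vars⊆ (act3 xs ys x) _ p with ++⁻ xs p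
  ... | inj₁ p∈xs = ++⁺ˡ p∈xs
  ... | inj₂ p∈ys = ++⁺ʳ xs (there p∈ys)
  step-vars⊆ (act4 xs ys t x _) _ p with ++⁻ xs p
  ... | inj₁ p∈xs         = ++⁺ˡ p∈xs
  ... | inj₂ (here p∈e)   = ++⁺ʳ xs (here (Sum.swap p∈e))
  ... | inj₂ (there p∈ys) = ++⁺ʳ xs (there p∈ys)
  step-vars⊆ (act5 xs ys x t _ _) z p = Sum.[ id , (λ z∈t → ++⁺ʳ xs (here (inj₂ z∈t))) ] (origin p)
    where
    σ : RawSubst F
    σ = [ x ↦ t ]
    origin : OccursInEqs z (subEqs σ xs ++ (var x , t) ∷ subEqs σ ys) →
             OccursInEqs z (xs ++ (var x , t) ∷ ys) ⊎ z occursIn t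
    origin p with ++⁻ (subEqs σ xs) p
    ... | inj₁ p∈xs         = Sum.map₁ (++⁺ˡ ∘ proj₁) (occurs-subEqs-↦⁻ xs p∈xs)
    ... | inj₂ (here p∈e)   = inj₁ (++⁺ʳ xs (here p∈e))
    ... | inj₂ (there p∈ys) = Sum.map₁ (++⁺ʳ xs ∘ there ∘ proj₁) (occurs-subEqs-↦⁻ ys p∈ys)

  -- Solved forms

  Solved : Eqns → Set
  Solved E = ∀ xs e ys → E ≡ xs ++ e ∷ ys →
    ∃₂ λ x t → e ≡ (var x , t) × ¬ x occursIn t × ¬ OccursInEqs x (xs ++ ys)

  terminal⇒solved : ∀ {E : Eqns} → Terminal E → Solved E
  terminal⇒solved stuck xs (var x , var y) ys refl with x ≟ y
  ... | yes refl = ⊥-elim (stuck a3 _ (act3 xs ys x))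
  ... | no x≢y with occursInEqs? x (xs ++ ys)
  ... | yes x∈E = ⊥-elim (stuck a5 _ (act5 xs ys x (var y) (x≢y ∘ occurs-var) x∈E))
  ... | no x∉E  = x , var y , refl , x≢y ∘ occurs-var , x∉E
  terminal⇒solved stuck xs (var x , fn g ts) ys refl with occurs? x (fn g ts)
  ... | yes x∈t = ⊥-elim (stuck a6 _ (act6 xs ys x (fn g ts) x∈t λ ()))
  ... | no x∉t with occursInEqs? x (xs ++ ys)
  ... | yes x∈E = ⊥-elim (stuck a5 _ (act5 xs ys x (fn g ts) x∉t x∈E))
  ... | no x∉E  = x , fn g ts , refl , x∉t , x∉E
  terminal⇒solved stuck xs (fn f ss , var y) ys refl = ⊥-elim (stuck a4 _ (act4 xs ys (fn f ss) y λ _ ()))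
  terminal⇒solved stuck xs (fn f ss , fn g ts) ys refl with length ss ≟ length ts
  ... | no len≢  = ⊥-elim (stuck a2 _ (act2 xs ys f g ss ts (inj₂ len≢)))
  ... | yes len≡ =
    ⊥-elim (stuck a2 _ (act2 xs ys f g ss ts (inj₁ λ { refl → stuck a1 _ (act1 xs ys f ss ts len≡) })))

  solved⇒terminal : ∀ {E : Eqns} → Solved E → Terminal E
  solved⇒terminal solved _ _ (act1 xs ys f ss ts _) with solved xs _ ys refl
  ... | _ , _ , () , _
  solved⇒terminal solved _ _ (act2 xs ys f g ss ts _) with solved xs _ ys refl
  ... | _ , _ , () , _
  solved⇒terminal solved _ _ (act3 xs ys x) with solved xs _ ys refl
  ... | _ , _ , refl , x∉x , _ = x∉x here
  solved⇒terminal solved _ _ (act4 xs ys t x t≢var) with solved xs _ ys refl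
  ... | y , _ , refl , _ , _ = t≢var y refl
  solved⇒terminal solved _ _ (act5 xs ys x t _ x∈E) with solved xs _ ys refl
  ... | _ , _ , refl , _ , x∉E = x∉E x∈E
  solved⇒terminal solved _ _ (act6 xs ys x t x∈t _) with solved xs _ ys refl
  ... | _ , _ , refl , x∉t , _ = x∉t x∈t

  Lhs : Eqns → ℕ → Set
  Lhs S z = ∃ λ u → (var z , u) ∈ S

  solved-∈ : ∀ {S : Eqns} {e} → Solved S → e ∈ S → ∃₂ λ x t → e ≡ (var x , t) × ¬ x occursIn t
  solved-∈ solved e∈S with ∈-∃++ e∈S
  ... | xs , ys , refl with solved xs _ ys refl
  ... | x , t , e≡x,t , x∉t , _ = x , t , e≡x,t , x∉t

  solved-lhs-unique : ∀ {S : Eqns} {z u e} → Solved S → (var z , u) ∈ S → e ∈ S → z occursInEq e →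
                      e ≡ (var z , u)
  solved-lhs-unique {e = e} solved z∈S e∈S z∈e with ∈-∃++ z∈S
  ... | xs , ys , refl with solved xs _ ys refl
  ... | _ , _ , refl , _ , z∉xs++ys with ∈-++⁻ xs e∈S
  ... | inj₁ e∈xs         = ⊥-elim (z∉xs++ys (++⁺ˡ (lose e∈xs z∈e)))
  ... | inj₂ (here e≡)    = e≡
  ... | inj₂ (there e∈ys) = ⊥-elim (z∉xs++ys (++⁺ʳ xs (lose e∈ys z∈e)))

  solved-lhs∉rhs : ∀ {S : Eqns} {z y s} → Solved S → Lhs S z → (var y , s) ∈ S → ¬ z occursIn s
  solved-lhs∉rhs solved (u , z∈S) y∈S z∈s
    with solved-lhs-unique solved z∈S y∈S (inj₂ z∈s) | solved-∈ solved y∈S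
  ... | refl | _ , _ , refl , z∉s = z∉s z∈s

  solution : Eqns → RawSubst F
  solution []                  y = var y
  solution ((var x , t) ∷ S)   y with y ≟ x
  ... | yes _ = t
  ... | no  _ = solution S y
  solution ((fn f ss , t) ∷ S) y = solution S y

  lhsVars : Eqns → List ℕ
  lhsVars []                  = []
  lhsVars ((var x , t) ∷ S)   = x ∷ lhsVars S
  lhsVars ((fn f ss , t) ∷ S) = lhsVars S

  solution-∉ : ∀ (S : Eqns) {y} → ¬ Lhs S y → solution S y ≡ var y
  solution-∉ []                  _   = refl
  solution-∉ ((var x , t) ∷ S)   {y} y∉S with y ≟ x
  ... | yes refl = ⊥-elim (y∉S (t , here refl))
  ... | no _     = solution-∉ S λ (u , y∈S) → y∉S (u , there y∈S)
  solution-∉ ((fn f ss , t) ∷ S) y∉S = solution-∉ S λ (u , y∈S) → y∉S (u , there y∈S)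

  lhs⇒∈lhsVars : ∀ (S : Eqns) {y} → Lhs S y → y ∈ lhsVars S
  lhs⇒∈lhsVars ((var x , t) ∷ S)   (u , here refl)  = here refl
  lhs⇒∈lhsVars ((var x , t) ∷ S)   (u , there y∈S) = there (lhs⇒∈lhsVars S (u , y∈S))
  lhs⇒∈lhsVars ((fn f ss , t) ∷ S) (u , there y∈S) = lhs⇒∈lhsVars S (u , y∈S)

  solutionSubst : Eqns → Subst F
  solutionSubst S = solution S , lhsVars S , λ y y∉ → solution-∉ S (y∉ ∘ lhs⇒∈lhsVars S)

  solution-lookup : ∀ (S : Eqns) {x t} → (var x , t) ∈ S → (∀ {u} → (var x , u) ∈ S → u ≡ t) → solution S x ≡ t
  solution-lookup ((var x′ , t′) ∷ S) {x} x∈S unique with x ≟ x′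
  ... | yes refl = unique (here refl)
  solution-lookup ((var x′ , t′) ∷ S) (here refl) unique | no x≢x′ = ⊥-elim (x≢x′ refl)
  solution-lookup ((var x′ , t′) ∷ S) (there x∈S) unique | no _ = solution-lookup S x∈S (unique ∘ there)
  solution-lookup ((fn f ss , t′) ∷ S) (there x∈S) unique = solution-lookup S x∈S (unique ∘ there)

  solution-unifies : ∀ {S : Eqns} → Solved S → Unifier (solution S) S
  solution-unifies {S} solved = All.tabulate unifies
    where
    unifies : ∀ {e} → e ∈ S → sub (proj₁ e) (solution S) ≡ sub (proj₂ e) (solution S)
    unifies e∈S with solved-∈ solved e∈S
    ... | x , t , refl , _ =
      trans (solution-lookup S e∈S λ u∈S → ,-injectiveʳ (solved-lhs-unique solved e∈S u∈S (inj₁ here)))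
            (sym (sub-identityOn t λ z z∈t → solution-∉ S λ z∈lhs → solved-lhs∉rhs solved z∈lhs e∈S z∈t))

  Apart : Eqns → Eqns → Set
  Apart P G = ∀ z → Lhs P z → ¬ OccursInEqs z G

  solved-↦ : ∀ {y} {s : Tm} (P : Eqns) → Solved P → ¬ Lhs P y → (∀ z → Lhs P z → ¬ z occursIn s) →
             Solved (subEqs [ y ↦ s ] P)
  solved-↦ {y} {s} P solved y∉lhs lhs∉s xs′ e′ ys′ eq with map≡++∷⁻ (subEq [ y ↦ s ]) P eq
  ... | xs , ys , _ , refl , refl , refl , refl with solved xs _ ys refl
  ... | x , u , refl , x∉u , x∉xs++ys =
    x , sub u [ y ↦ s ] , cong (_, _) (↦-other s x≢y) ,
    Sum.[ x∉u ∘ proj₁ , x∉s ] ∘ occurs-↦⁻ u s ,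
    Sum.[ x∉xs++ys ∘ proj₁ , x∉s ] ∘ occurs-subEqs-↦⁻ (xs ++ ys) ∘ subst (OccursInEqs x) (sym (map-++ _ xs ys))
    where
    x∈lhs : Lhs P x
    x∈lhs = u , ∈-insert xs
    x≢y : x ≢ y
    x≢y refl = y∉lhs x∈lhs
    x∉s : ¬ x occursIn s
    x∉s = lhs∉s x x∈lhs

  lhs-↦ : ∀ {y z} {s : Tm} (P : Eqns) → ¬ Lhs P y → Lhs (subEqs [ y ↦ s ] P) z → Lhs P z
  lhs-↦ {y} {z} {s} P y∉lhs (u , z∈P′) with ∈-map⁻ (subEq [ y ↦ s ]) z∈P′
  ... | (fn g us , v) , _    , ()
  ... | (var w , v)   , w∈P , eq with w ≟ y
  ... | yes refl = ⊥-elim (y∉lhs (v , w∈P))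
  ... | no w≢y with trans (,-injectiveˡ eq) (↦-other s w≢y)
  ... | refl = v , w∈P

  Apart-⊆ : ∀ {P G G′ : Eqns} → Apart P G → G′ ⊆ᵛ G → Apart P G′
  Apart-⊆ P#G ⊆G z z∈P = P#G z z∈P ∘ ⊆G z

  solved-apart-↦ : ∀ {P G : Eqns} {x t} → Solved P → Apart P G → (var x , t) ∈ G →
                   Solved (subEqs [ x ↦ t ] P) × Apart (subEqs [ x ↦ t ] P) G
  solved-apart-↦ {P} solved P#G x∈G =
    solved-↦ P solved x∉lhs (λ z z∈lhs z∈t → P#G z z∈lhs (lose x∈G (inj₂ z∈t))) ,
    λ z z∈lhs → P#G z (lhs-↦ P x∉lhs z∈lhs)
    where
    x∉lhs : ¬ Lhs P _
    x∉lhs = λ x∈lhs → P#G _ x∈lhs (lose x∈G (inj₁ here))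

  update-solved-apart : ∀ {P G : Eqns} (u : Update G) → Solved P → Apart P G →
                        Solved (apply u P) × Apart (apply u P) G
  update-solved-apart keep                 solved P#G = solved , P#G
  update-solved-apart (eliminate _ _ x∈G) solved P#G = solved-apart-↦ solved P#G x∈G

  solved-++ : ∀ {P T : Eqns} → Solved P → Solved T → Apart P T → Apart T P → Solved (P ++ T)
  solved-++ {P} {T} solvedP solvedT P#T T#P xs e ys eq with ++∷≡++⁻ xs {P = P} {T = T} (sym eq)
  ... | inj₁ (ys₁ , refl , refl) with solvedP xs e ys₁ refl
  ... | x , t , refl , x∉t , x∉P = x , t , refl , x∉t , x∉rest
    where
    x∉rest : ¬ OccursInEqs x (xs ++ ys₁ ++ T)
    x∉rest p with ++⁻ xs p
    ... | inj₁ p∈xs = x∉P (++⁺ˡ p∈xs)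
    ... | inj₂ p∈ys₁T with ++⁻ ys₁ p∈ys₁T
    ... | inj₁ p∈ys₁ = x∉P (++⁺ʳ xs p∈ys₁)
    ... | inj₂ p∈T   = P#T x (t , ∈-insert xs) p∈T
  solved-++ {P} {T} solvedP solvedT P#T T#P _ e ys eq | inj₂ (xs₂ , refl , refl) with solvedT xs₂ e ys refl
  ... | x , t , refl , x∉t , x∉T = x , t , refl , x∉t , x∉rest
    where
    x∉rest : ¬ OccursInEqs x ((P ++ xs₂) ++ ys)
    x∉rest p with ++⁻ P (subst (OccursInEqs x) (++-assoc P xs₂ ys) p)
    ... | inj₁ p∈P = T#P x (t , ∈-insert xs₂) p∈P
    ... | inj₂ p∈T = x∉T p∈T

  eliminate-step : ∀ {y s} (P A B G : Eqns) → ¬ y occursIn s → ¬ OccursInEqs y (A ++ B) → OccursInEqs y (P ++ G) →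
                   (P ++ (A ++ (var y , s) ∷ B) ++ G) ⟶
                   (subEqs [ y ↦ s ] P ++ (A ++ (var y , s) ∷ B) ++ subEqs [ y ↦ s ] G)
  eliminate-step {y} {s} P A B G y∉s y∉AB y∈PG =
    a5 , (λ ()) , Step-cast (sym (reassoc P A _ G)) result (act5 (P ++ A) (B ++ G) y s y∉s y∈context)
    where
    σ : RawSubst F
    σ = [ y ↦ s ]
    y∈context : OccursInEqs y ((P ++ A) ++ B ++ G)
    y∈context = Sum.[ ++⁺ˡ ∘ ++⁺ˡ , ++⁺ʳ (P ++ A) ∘ ++⁺ʳ B ] (++⁻ P y∈PG)
    result : subEqs σ (P ++ A) ++ (var y , s) ∷ subEqs σ (B ++ G) ≡
             subEqs σ P ++ (A ++ (var y , s) ∷ B) ++ subEqs σ G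
    result = begin
      subEqs σ (P ++ A) ++ (var y , s) ∷ subEqs σ (B ++ G)
        ≡⟨ cong₂ (λ L L′ → L ++ (var y , s) ∷ L′) (map-++ _ P A) (map-++ _ B G) ⟩
      (subEqs σ P ++ subEqs σ A) ++ (var y , s) ∷ subEqs σ B ++ subEqs σ G
        ≡⟨ cong₂ (λ L L′ → (subEqs σ P ++ L) ++ (var y , s) ∷ L′ ++ subEqs σ G)
                 (subEqs-↦-fresh A (y∉AB ∘ ++⁺ˡ)) (subEqs-↦-fresh B (y∉AB ∘ ++⁺ʳ A)) ⟩
      (subEqs σ P ++ A) ++ (var y , s) ∷ B ++ subEqs σ G
        ≡⟨ sym (reassoc (subEqs σ P) A _ (subEqs σ G)) ⟩
      subEqs σ P ++ (A ++ (var y , s) ∷ B) ++ subEqs σ G ∎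
      where open ≡-Reasoning

  lhs-∷ʳ⁻ : ∀ (A : Eqns) {y s z} → Lhs (A ++ [ (var y , s) ]) z → Lhs A z ⊎ z ≡ y
  lhs-∷ʳ⁻ A (u , z∈A′) with ∈-++⁻ A z∈A′
  ... | inj₁ z∈A         = inj₁ (u , z∈A)
  ... | inj₂ (here refl) = inj₂ refl

  apart-∷ʳ-↦ : ∀ {S A G : Eqns} {y s} → Solved S → (∀ {z} → Lhs A z → Lhs S z) → (var y , s) ∈ S → Apart A G →
               Apart (A ++ [ (var y , s) ]) (subEqs [ y ↦ s ] G)
  apart-∷ʳ-↦ {A = A} {G} solved A⊆S y∈S A#G z z∈A′ z∈σG with lhs-∷ʳ⁻ A z∈A′ | occurs-subEqs-↦⁻ G z∈σG
  ... | inj₁ z∈A  | inj₁ (z∈G , _) = A#G z z∈A z∈G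
  ... | inj₁ z∈A  | inj₂ z∈s       = solved-lhs∉rhs solved (A⊆S z∈A) y∈S z∈s
  ... | inj₂ refl | inj₁ (_ , z≢y) = z≢y refl
  ... | inj₂ refl | inj₂ y∈s       = solved-lhs∉rhs solved (_ , y∈S) y∈S y∈s

  eliminate-solved : ∀ {S : Eqns} → Solved S → (Q : Eqns → Eqns → Set) →
                     (∀ {x t P G} → (var x , t) ∈ S → Q P G → Q (subEqs [ x ↦ t ] P) (subEqs [ x ↦ t ] G)) →
                     ∀ {P G} → Q P G →
                     ∃₂ λ P′ G′ → (P ++ S ++ G) ⟶* (P′ ++ S ++ G′) × Q P′ G′ × Apart S (P′ ++ G′)
  eliminate-solved {S} solved Q preserve q = go [] S refl q λ _ ()
    where
    shift : ∀ {A e B} → S ≡ A ++ e ∷ B → S ≡ (A ++ [ e ]) ++ B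
    shift {A} {e} {B} eq = trans eq (sym (++-assoc A [ e ] B))

    -- A is the part of S whose variables have already been eliminated from the context.
    go : ∀ A B → S ≡ A ++ B → ∀ {P G} → Q P G → Apart A (P ++ G) →
         ∃₂ λ P′ G′ → (P ++ S ++ G) ⟶* (P′ ++ S ++ G′) × Q P′ G′ × Apart S (P′ ++ G′)
    go A [] S≡A {P} {G} q A#PG =
      P , G , ε , q , λ z → A#PG z ∘ subst (λ L → Lhs L z) (trans S≡A (++-identityʳ A))
    go A (e ∷ B) S≡A++e∷B {P} {G} q A#PG with solved A e B S≡A++e∷B
    ... | y , s , refl , y∉s , y∉AB with occursInEqs? y (P ++ G)
    ... | no y∉PG =
      go (A ++ [ _ ]) B (shift S≡A++e∷B) q λ z z∈A′ → Sum.[ A#PG z , (λ { refl → y∉PG }) ] (lhs-∷ʳ⁻ A z∈A′)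
    ... | yes y∈PG with go (A ++ [ _ ]) B (shift S≡A++e∷B) (preserve y∈S q) A′#σPG
      where
      y∈S : (var y , s) ∈ S
      y∈S = subst ((var y , s) ∈_) (sym S≡A++e∷B) (∈-insert A)
      A⊆S : ∀ {z} → Lhs A z → Lhs S z
      A⊆S (u , z∈A) = u , subst ((var _ , u) ∈_) (sym S≡A++e∷B) (∈-++⁺ˡ z∈A)
      A′#σPG : Apart (A ++ [ (var y , s) ]) (subEqs [ y ↦ s ] P ++ subEqs [ y ↦ s ] G)
      A′#σPG = subst (Apart _) (map-++ _ P G) (apart-∷ʳ-↦ solved A⊆S y∈S A#PG)
    ... | P′ , G′ , steps , q′ , S#P′G′ = P′ , G′ , eliminate-y ◅ steps , q′ , S#P′G′
      where
      eliminate-y : (P ++ S ++ G) ⟶ (subEqs [ y ↦ s ] P ++ S ++ subEqs [ y ↦ s ] G)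
      eliminate-y = subst (λ L → (P ++ L ++ G) ⟶ (subEqs [ y ↦ s ] P ++ L ++ subEqs [ y ↦ s ] G))
                          (sym S≡A++e∷B) (eliminate-step P A B G y∉s y∉AB y∈PG)

  eliminate-solvedʳ : ∀ {S : Eqns} → Solved S → ∀ G → ∃ λ G′ →
                      (S ++ G) ⟶* (S ++ G′) × Apart S G′ × (∀ η → Unifier η S → subEqs η G′ ≡ subEqs η G)
  eliminate-solvedʳ {S} solved G with eliminate-solved solved Q preserve {[]} {G} (refl , λ _ _ → refl)
    where
    Q : Eqns → Eqns → Set
    Q P G′ = P ≡ [] × (∀ η → Unifier η S → subEqs η G′ ≡ subEqs η G)
    preserve : ∀ {x t P G′} → (var x , t) ∈ S → Q P G′ → Q (subEqs [ x ↦ t ] P) (subEqs [ x ↦ t ] G′)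
    preserve x∈S (refl , absorbed) = refl , λ η u → trans (subEqs-↦-absorb η (All.lookup u x∈S) _) (absorbed η u)
  ... | _ , G′ , steps , (refl , absorbed) , S#G′ = G′ , steps , S#G′ , absorbed

  -- Renamings

  IsRenamingOn : RawSubst F → Eqns → Set
  IsRenamingOn δ E = (∀ x → OccursInEqs x E → ∃ λ y → δ x ≡ var y) ×
                     (∀ x x′ → OccursInEqs x E → OccursInEqs x′ E → δ x ≡ δ x′ → x ≡ x′)

  renaming-⊆ : ∀ {δ} {E E′ : Eqns} → IsRenamingOn δ E → E′ ⊆ᵛ E → IsRenamingOn δ E′
  renaming-⊆ (toVar , injective) ⊆E = (λ x → toVar x ∘ ⊆E x) , λ x x′ p p′ → injective x x′ (⊆E x p) (⊆E x′ p′)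

  renaming-occurs : ∀ {δ} {E : Eqns} {x y z} → IsRenamingOn δ E → δ x ≡ var y →
                    OccursInEqs x E → OccursInEqs z E → y occursIn δ z → z ≡ x
  renaming-occurs (toVar , injective) δx≡y x∈E z∈E y∈δz with toVar _ z∈E
  ... | z′ , δz≡z′ with occurs-var (subst (_ occursIn_) δz≡z′ y∈δz)
  ... | refl = injective _ _ z∈E x∈E (trans δz≡z′ (sym δx≡y))

  renaming-fresh : ∀ {δ} {E : Eqns} {x y} (t : Tm) → IsRenamingOn δ E → δ x ≡ var y → OccursInEqs x E →
                   (∀ z → z occursIn t → OccursInEqs z E) → ¬ x occursIn t → ¬ y occursIn sub t δ
  renaming-fresh t ren δx≡y x∈E t⊆E x∉t y∈δt with occurs-sub⁻ t _ y∈δt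
  ... | z , z∈t , y∈δz with renaming-occurs ren δx≡y x∈E (t⊆E z z∈t) y∈δz
  ... | refl = x∉t z∈t

  renaming-freshEqs : ∀ {δ} {E : Eqns} {x y} (L : Eqns) → IsRenamingOn δ E → δ x ≡ var y → OccursInEqs x E →
                      L ⊆ᵛ E → ¬ OccursInEqs x L → ¬ OccursInEqs y (subEqs δ L)
  renaming-freshEqs L ren δx≡y x∈E L⊆E x∉L y∈δL with occurs-subEqs⁻ _ L y∈δL
  ... | z , z∈L , y∈δz with renaming-occurs ren δx≡y x∈E (L⊆E z z∈L) y∈δz
  ... | refl = x∉L z∈L

  renaming-↦ : ∀ {δ} {E : Eqns} {x y} (t : Tm) (L : Eqns) → IsRenamingOn δ E → δ x ≡ var y → OccursInEqs x E →
               L ⊆ᵛ E →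
               subEqs [ y ↦ sub t δ ] (subEqs δ L) ≡ subEqs δ (subEqs [ x ↦ t ] L)
  renaming-↦ {δ} {x = x} {y} t L ren@(toVar , _) δx≡y x∈E L⊆E =
    trans (subEqs-⨾ L δ [ y ↦ sub t δ ]) (trans (subEqs-cong L commute) (sym (subEqs-⨾ L [ x ↦ t ] δ)))
    where
    commute : ∀ z → OccursInEqs z L → sub (δ z) [ y ↦ sub t δ ] ≡ sub ([ x ↦ t ] z) δ
    commute z z∈L with z ≟ x
    ... | yes refl = begin
      sub (δ x) [ y ↦ sub t δ ]  ≡⟨ cong (λ v → sub v [ y ↦ sub t δ ]) δx≡y ⟩
      [ y ↦ sub t δ ] y          ≡⟨ ↦-self y (sub t δ) ⟩
      sub t δ                    ≡⟨ cong (λ v → sub v δ) (↦-self x t) ⟨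
      sub ([ x ↦ t ] x) δ        ∎
      where open ≡-Reasoning
    ... | no z≢x with toVar z (L⊆E z z∈L)
    ... | z′ , δz≡z′ = begin
      sub (δ z) [ y ↦ sub t δ ]  ≡⟨ cong (λ v → sub v [ y ↦ sub t δ ]) δz≡z′ ⟩
      [ y ↦ sub t δ ] z′         ≡⟨ ↦-other (sub t δ) z′≢y ⟩
      var z′                     ≡⟨ δz≡z′ ⟨
      δ z                        ≡⟨ cong (λ v → sub v δ) (↦-other t z≢x) ⟨
      sub ([ x ↦ t ] z) δ        ∎
      where
      open ≡-Reasoning
      z′≢y : z′ ≢ y
      z′≢y refl = z≢x (renaming-occurs ren δx≡y x∈E (L⊆E z z∈L) (subst (_ occursIn_) (sym δz≡z′) here))

  subEqs-zip : ∀ σ (ss ts : List Tm) → subEqs σ (zip ss ts) ≡ zip (subs ss σ) (subs ts σ)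
  subEqs-zip σ []       ts       = refl
  subEqs-zip σ (s ∷ ss) []       = refl
  subEqs-zip σ (s ∷ ss) (t ∷ ts) = cong (_ ∷_) (subEqs-zip σ ss ts)

  rename-step : ∀ {δ a} {E E′ : Eqns} → IsRenamingOn δ E → Step a E (cont E′) →
                Step a (subEqs δ E) (cont (subEqs δ E′))
  rename-step {δ} _ (act1 xs ys f ss ts len) =
    Step-cast (sym (map-++ _ xs _)) (sym result)
              (act1 (subEqs δ xs) (subEqs δ ys) f (subs ss δ) (subs ts δ)
                    (trans (length-subs ss δ) (trans len (sym (length-subs ts δ)))))
    where
    result : subEqs δ (xs ++ zip ss ts ++ ys) ≡ subEqs δ xs ++ zip (subs ss δ) (subs ts δ) ++ subEqs δ ys
    result = trans (map-++ _ xs _) (cong (subEqs δ xs ++_)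
                   (trans (map-++ _ (zip ss ts) ys) (cong (_++ subEqs δ ys) (subEqs-zip δ ss ts))))
  rename-step {δ} (toVar , _) (act3 xs ys x) with toVar x (++⁺ʳ xs (here (inj₁ here)))
  ... | y , δx≡y =
    Step-cast (trans (cong (λ v → subEqs δ xs ++ (v , v) ∷ subEqs δ ys) (sym δx≡y)) (sym (map-++ _ xs _)))
              (sym (map-++ _ xs ys))
              (act3 (subEqs δ xs) (subEqs δ ys) y)
  rename-step _ (act4 xs ys (var z) x t≢var) = ⊥-elim (t≢var z refl)
  rename-step {δ} (toVar , _) (act4 xs ys (fn g us) x _) with toVar x (++⁺ʳ xs (here (inj₂ here)))
  ... | y , δx≡y =
    Step-cast (trans (cong (λ v → subEqs δ xs ++ (t′ , v) ∷ subEqs δ ys) (sym δx≡y)) (sym (map-++ _ xs _)))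
              (trans (cong (λ v → subEqs δ xs ++ (v , t′) ∷ subEqs δ ys) (sym δx≡y)) (sym (map-++ _ xs _)))
              (act4 (subEqs δ xs) (subEqs δ ys) t′ y λ _ ())
    where
    t′ : Tm
    t′ = fn g (subs us δ)
  rename-step {δ} {E = E} ren@(toVar , _) (act5 xs ys x t x∉t x∈xs++ys) =
    Step-cast (trans (cong (λ v → subEqs δ xs ++ (v , sub t δ) ∷ subEqs δ ys) (sym δx≡y)) (sym (map-++ _ xs _)))
              (trans (cong₂ _++_ (renaming-↦ t xs ren δx≡y x∈E (λ _ → ++⁺ˡ))
                                 (cong₂ _∷_ (cong (_, sub t δ) (sym δx≡y))
                                            (renaming-↦ t ys ren δx≡y x∈E (λ _ → ++⁺ʳ xs ∘ there))))
                     (sym (map-++ _ (subEqs [ x ↦ t ] xs) _)))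
              (act5 (subEqs δ xs) (subEqs δ ys) y (sub t δ)
                    (renaming-fresh t ren δx≡y x∈E (λ _ z∈t → ++⁺ʳ xs (here (inj₂ z∈t))) x∉t)
                    (subst (OccursInEqs y) (map-++ _ xs ys)
                           (occurs-subEqs⁺ δ (xs ++ ys) x∈xs++ys (subst (y occursIn_) (sym δx≡y) here))))
    where
    x∈E : OccursInEqs x E
    x∈E = ++⁺ʳ xs (here (inj₁ here))
    y : ℕ
    y = proj₁ (toVar x x∈E)
    δx≡y : δ x ≡ var y
    δx≡y = proj₂ (toVar x x∈E)

  sub-failure : ∀ {a} {E : Eqns} δ → a ≢ a6 → Step a E failure → Step a (subEqs δ E) failure
  sub-failure δ _ (act2 xs ys f g ss ts clash) =
    subst (λ L → Step a2 L failure) (sym (map-++ _ xs _))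
          (act2 (subEqs δ xs) (subEqs δ ys) f g (subs ss δ) (subs ts δ)
                (Sum.map₂ (λ len≢ len → len≢ (trans (sym (length-subs ss δ)) (trans len (length-subs ts δ)))) clash))
  sub-failure δ a6≢a6 (act6 _ _ _ _ _ _) = ⊥-elim (a6≢a6 refl)

  rename-solved : ∀ {δ} {E : Eqns} → IsRenamingOn δ E → Solved E → Solved (subEqs δ E)
  rename-solved {δ} {E} ren solved xs′ e′ ys′ eq with map≡++∷⁻ (subEq δ) E eq
  ... | xs , ys , _ , refl , refl , refl , refl with solved xs _ ys refl
  ... | x , t , refl , x∉t , x∉xs++ys =
    y , sub t δ , cong (_, sub t δ) δx≡y ,
    renaming-fresh t ren δx≡y x∈E (λ _ z∈t → ++⁺ʳ xs (here (inj₂ z∈t))) x∉t ,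
    renaming-freshEqs (xs ++ ys) ren δx≡y x∈E xs++ys⊆E x∉xs++ys ∘ subst (OccursInEqs y) (sym (map-++ _ xs ys))
    where
    x∈E : OccursInEqs x E
    x∈E = ++⁺ʳ xs (here (inj₁ here))
    y : ℕ
    y = proj₁ (proj₁ ren x x∈E)
    δx≡y : δ x ≡ var y
    δx≡y = proj₂ (proj₁ ren x x∈E)
    xs++ys⊆E : ∀ z → OccursInEqs z (xs ++ ys) → OccursInEqs z E
    xs++ys⊆E z = Sum.[ ++⁺ˡ , ++⁺ʳ xs ∘ there ] ∘ ++⁻ xs

  rename-run : ∀ {δ} {E : Eqns} → IsRenamingOn δ E → Run¬6 E → Run¬6 (subEqs δ E)
  rename-run ren (halt stuck)     = halt (solved⇒terminal (rename-solved ren (terminal⇒solved stuck)))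
  rename-run ren (failStep a≢6 s) = failStep a≢6 (sub-failure _ a≢6 s)
  rename-run ren (step a≢6 s run) = step a≢6 (rename-step ren s) (rename-run (renaming-⊆ ren (step-vars⊆ s)) run)

  rename-infRun : ∀ {δ} {E : Eqns} → IsRenamingOn δ E → InfRun¬6 E → InfRun¬6 (subEqs δ E)
  rename-infRun {δ} ren (run , refl , next) = subEqs δ ∘ run , refl , next′
    where
    renamingAt : ∀ n → IsRenamingOn δ (run n)
    renamingAt zero    = ren
    renamingAt (suc n) = renaming-⊆ (renamingAt n) (step-vars⊆ (proj₂ (proj₂ (next n))))
    next′ : ∀ n → Σ Action λ a → a ≢ a6 × Step a (subEqs δ (run n)) (cont (subEqs δ (run (suc n))))
    next′ n = Product.map₂ (Product.map₂ (rename-step (renamingAt n))) (next n)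

  wnsto-rename : ∀ {δ} {E : Eqns} → IsRenamingOn δ E → WNSTO E → WNSTO (subEqs δ E)
  wnsto-rename ren = Sum.map (rename-run ren) (rename-infRun ren)

  -- Running E₁ inside E₁ ∪ E₂

  Halted : Eqns → Set
  Halted E = Terminal E ⊎ ∃ λ a → a ≢ a6 × Step a E failure

  update-absorbed : ∀ {E′ : Eqns} η → Unifier η E′ → (u : Update E′) (G : Eqns) →
                    subEqs η (apply u G) ≡ subEqs η G
  update-absorbed η _ keep                  G = refl
  update-absorbed η u (eliminate x t x∈E′) G = subEqs-↦-absorb η (All.lookup u x∈E′) G

  run-in-context : ∀ {E : Eqns} → Run¬6 E → (G : Eqns) → ∃₂ λ E′ G′ →
                   E ⟶* E′ × (E ++ G) ⟶* (E′ ++ G′) × (∀ η → Unifier η E → subEqs η G′ ≡ subEqs η G) × Halted E′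
  run-in-context (halt stuck)     G = _ , G , ε , ε , (λ _ _ → refl) , inj₁ stuck
  run-in-context (failStep a≢6 s) G = _ , G , ε , ε , (λ _ _ → refl) , inj₂ (_ , a≢6 , s)
  run-in-context (step a≢6 s run) G with run-in-context run (apply (step-update s) G)
  ... | E′ , G′ , steps , stepsG , absorbed , halted =
    E′ , G′ , (_ , a≢6 , s) ◅ steps , (_ , a≢6 , step-++ʳ s G) ◅ stepsG ,
    (λ η u → let u′ = unifier-step⁺ η s u in trans (absorbed η u′) (update-absorbed η u′ (step-update s) G)) ,
    halted

  wnsto-++-¬unifiable : ∀ {E : Eqns} → Run¬6 E → ¬ Unifiable E → ∀ G → WNSTO (E ++ G)
  wnsto-++-¬unifiable run ¬unifiable G with run-in-context run G
  ... | S , _ , steps , _ , _ , inj₁ stuck =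
    ⊥-elim (¬unifiable (solutionSubst S , unifier-steps⁻ _ steps (solution-unifies (terminal⇒solved stuck))))
  ... | _ , G′ , _ , stepsG , _ , inj₂ (_ , a≢6 , s) =
    wnsto-prepend stepsG (inj₁ (failStep a≢6 (failure-in-context s [] G′)))

  wnsto-solved-++-solved : ∀ {P T : Eqns} → Solved P → Apart P T → Solved T → WNSTO (P ++ T)
  wnsto-solved-++-solved {P} {T} solvedP P#T solvedT
    with eliminate-solved solvedT Q preserve {P} {[]} (refl , solvedP , P#T)
    where
    Q : Eqns → Eqns → Set
    Q P′ G′ = G′ ≡ [] × Solved P′ × Apart P′ T
    preserve : ∀ {x t P′ G′} → (var x , t) ∈ T → Q P′ G′ → Q (subEqs [ x ↦ t ] P′) (subEqs [ x ↦ t ] G′)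
    preserve x∈T (refl , solved , P′#T) = refl , solved-apart-↦ solved P′#T x∈T
  ... | P′ , _ , steps , (refl , solvedP′ , P′#T) , T#P′ =
    wnsto-prepend (subst (λ L → (P ++ L) ⟶* (P′ ++ L)) (++-identityʳ T) steps)
                  (inj₁ (halt (solved⇒terminal (solved-++ solvedP′ solvedT P′#T λ z z∈lhs → T#P′ z z∈lhs ∘ ++⁺ˡ))))

  wnsto-solved-++-run : ∀ {P G : Eqns} → Run¬6 G → Solved P → Apart P G → WNSTO (P ++ G)
  wnsto-solved-++-run (halt stuck) solved P#G = wnsto-solved-++-solved solved P#G (terminal⇒solved stuck)
  wnsto-solved-++-run {P} (failStep a≢6 s) _ _ =
    inj₁ (failStep a≢6 (subst (λ L → Step _ (P ++ L) failure) (++-identityʳ _) (failure-in-context s P [])))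
  wnsto-solved-++-run {P} (step a≢6 s run) solved P#G =
    wnsto-prepend ((_ , a≢6 , step-++ˡ s P) ◅ ε)
                  (Product.uncurry (wnsto-solved-++-run run)
                                   (update-solved-apart (step-update s) solved (Apart-⊆ P#G (step-vars⊆ s))))

  wnsto-solved-++ : ∀ {P G : Eqns} → WNSTO G → Solved P → Apart P G → WNSTO (P ++ G)
  wnsto-solved-++     (inj₁ run) solved P#G = wnsto-solved-++-run run solved P#G
  wnsto-solved-++ {P} (inj₂ inf) _      _   =
    inj₂ (subst (λ L → InfRun¬6 (P ++ L)) (++-identityʳ _) (infRun-in-context inf P []))

  -- The hypothesis makes θ an injective renaming on the variables of G, undone by δ.
  wnsto-subst⁻ : ∀ θ δ (G : Eqns) → (∀ z → OccursInEqs z G → sub (θ z) δ ≡ var z) → WNSTO (subEqs θ G) → WNSTO G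
  wnsto-subst⁻ θ δ G inverse =
    subst WNSTO (trans (subEqs-⨾ G θ δ) (subEqs-identityOn G inverse)) ∘ wnsto-rename δ-renames
    where
    preimage : ∀ w → OccursInEqs w (subEqs θ G) → ∃ λ z → θ z ≡ var w × δ w ≡ var z
    preimage w w∈θG with occurs-subEqs⁻ θ G w∈θG
    ... | z , z∈G , w∈θz with sub≡var⁻ (θ z) δ (inverse z z∈G)
    ... | w′ , θz≡w′ , δw′≡z with occurs-var (subst (w occursIn_) θz≡w′ w∈θz)
    ... | refl = z , θz≡w′ , δw′≡z
    δ-renames : IsRenamingOn δ (subEqs θ G)
    δ-renames = (λ w → Product.map₂ proj₂ ∘ preimage w) , injective
      where
      injective : ∀ w₁ w₂ → OccursInEqs w₁ (subEqs θ G) → OccursInEqs w₂ (subEqs θ G) → δ w₁ ≡ δ w₂ → w₁ ≡ w₂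
      injective w₁ w₂ p₁ p₂ δw₁≡δw₂ with preimage w₁ p₁ | preimage w₂ p₂
      ... | z₁ , θz₁≡w₁ , δw₁≡z₁ | z₂ , θz₂≡w₂ , δw₂≡z₂
        with var-injective (trans (sym δw₁≡z₁) (trans δw₁≡δw₂ δw₂≡z₂))
      ... | refl = var-injective (trans (sym θz₁≡w₁) θz₂≡w₂)

  wnsto-solved-++-instance : ∀ {E₁ S : Eqns} {θ} → IsMGU θ E₁ → E₁ ⟶* S → Solved S →
                             ∀ G → WNSTO (subEqs θ G) → WNSTO (S ++ G)
  wnsto-solved-++-instance {S = S} {θ} (θ-unifies , mostGeneral) steps solved G w
    with eliminate-solvedʳ solved G | mostGeneral (solutionSubst S) (unifier-steps⁻ _ steps (solution-unifies solved))
  ... | G′ , stepsS , S#G′ , absorbed | (δ , _) , factor =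
    wnsto-prepend stepsS (wnsto-solved-++ (wnsto-subst⁻ θ δ G′ inverse (subst WNSTO θG≡θG′ w)) solved S#G′)
    where
    θG≡θG′ : subEqs θ G ≡ subEqs θ G′
    θG≡θG′ = sym (absorbed θ (unifier-steps⁺ θ steps θ-unifies))
    inverse : ∀ z → OccursInEqs z G′ → sub (θ z) δ ≡ var z
    inverse z z∈G′ = trans (sym (factor z)) (solution-∉ S λ z∈lhs → S#G′ z z∈lhs z∈G′)

  wnsto-++-mgu : ∀ {E₁ : Eqns} {θ} → Run¬6 E₁ → IsMGU θ E₁ → ∀ E₂ → WNSTO (subEqs θ E₂) → WNSTO (E₁ ++ E₂)
  wnsto-++-mgu {θ = θ} run mgu@(θ-unifies , _) E₂ w with run-in-context run E₂
  ... | _ , _ , steps , _ , _ , inj₂ (_ , a≢6 , s) =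
    ⊥-elim (failure-¬unifier θ a≢6 s (unifier-steps⁺ θ steps θ-unifies))
  ... | S , G , steps , stepsG , absorbed , inj₁ stuck =
    wnsto-prepend stepsG (wnsto-solved-++-instance mgu steps (terminal⇒solved stuck) G
                                                   (subst WNSTO (sym (absorbed θ θ-unifies)) w))

lemma13 : {F : Set} (E₁ E₂ : List (Eqn F)) → WNSTO E₁ →
          ((¬ Unifiable E₁ → WNSTO (E₁ ++ E₂)) ×
           ((θ₁ : Subst F) → IsMGU (proj₁ θ₁) E₁ →
              WNSTO (map (subEq (proj₁ θ₁)) E₂) → WNSTO (E₁ ++ E₂)))
lemma13 E₁ E₂ (inj₁ run) = (λ ¬unifiable → wnsto-++-¬unifiable run ¬unifiable E₂) ,
                           λ θ₁ mgu → wnsto-++-mgu run mgu E₂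
lemma13 E₁ E₂ (inj₂ inf) = const w , λ _ _ → const w
  where
  w : WNSTO (E₁ ++ E₂)
  w = inj₂ (infRun-in-context inf [] E₂)
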